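{- Let $k\ge 3$ and $0\le m\le p_{k+1}-3$ be integers and write $G(p_k,m)=\frac{Q_1Q_2\cdots Q_s}{q_1q_2\cdots q_s}$ as the maximizing fraction in the definition of $G$. If $F$ is a real number with $1<F\le G(p_k,m)$, then the largest prime $Q_s$ of the numerator satisfies \[Q_s\le\min\left(p_k+m,\ \frac{mF}{F-1}\right).\]
   Context: $p_i$ denotes the $i$-th prime. For $k\ge3$ and $0\le m\le p_{k+1}-3$, $G(p_k,m)$ is the maximum of $\frac{Q_1\cdots Q_s}{q_1\cdots q_s}$ over $s\ge0$ and primes $3\le q_s<\dots<q_1\le p_k<p_{k+1}\le Q_1<\dots<Q_s$ with $\sum_{i=1}^s(Q_i-q_i)\le m$ (empty product $=1$ for $s=0$); the maximizing fraction is unique, and when $G(p_k,m)>1$ it has $s\ge1$.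
   Formalization: The number F with $1<F\le G(p_k,m)$ ranges over the rationals rather than the reals. -}

module Defs where

open import Data.Nat as ℕ using (ℕ; zero; suc; _≤_; _<_)
open import Data.Nat.Primality using (Prime; prime?)
open import Data.Integer using (+_)
open import Data.Rational as ℚ using (ℚ; 0ℚ; 1ℚ; _/_; _÷_; _-_; _⊓_)
import Data.Rational.Properties as ℚP
open import Data.List using (List; []; _∷_; map)
open import Data.Nat.ListAction using (sum; product)
open import Data.Product using (_×_; _,_; proj₁; proj₂)
open import Relation.Nullary.Decidable using (does)
open import Data.Bool using (if_then_else_)
open import Relation.Binary.PropositionalEquality using (_≡_; subst)

π : ℕ → ℕ
π zero = 0
π (suc n) = if does (prime? (suc n)) then suc (π n) else π n

IsKthPrime : ℕ → ℕ → Set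
IsKthPrime k p = Prime p × π p ≡ k

-- A configuration is the list of pairs (q_i , Q_i) for i = 1 , … , s.
Config : Set
Config = List (ℕ × ℕ)

data QsDecr : List ℕ → Set where
  []  : QsDecr []
  [_] : ∀ x → QsDecr (x ∷ [])
  _∷_ : ∀ {x y xs} → y < x → QsDecr (y ∷ xs) → QsDecr (x ∷ y ∷ xs)

data QsIncr : List ℕ → Set where
  []  : QsIncr []
  [_] : ∀ x → QsIncr (x ∷ [])
  _∷_ : ∀ {x y xs} → x < y → QsIncr (y ∷ xs) → QsIncr (x ∷ y ∷ xs)

lows highs : Config → List ℕ
lows  = map proj₁
highs = map proj₂

-- ∑ (Q_i - q_i)  (truncated subtraction; Q_i > q_i for admissible configurations)
cost : Config → ℕ
cost c = sum (map (λ x → proj₂ x ℕ.∸ proj₁ x) c)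

data AllL (P : ℕ × ℕ → Set) : Config → Set where
  []  : AllL P []
  _∷_ : ∀ {x xs} → P x → AllL P xs → AllL P (x ∷ xs)

Admissible : (p P m : ℕ) → Config → Set
Admissible p P m c =
  AllL (λ x → Prime (proj₁ x) × 3 ≤ proj₁ x × proj₁ x ≤ p
            × Prime (proj₂ x) × P ≤ proj₂ x) c
  × QsDecr (lows c) × QsIncr (highs c) × cost c ≤ m

-- n / d as a rational number (d = 0 never occurs for admissible configurations,
-- whose denominators are products of odd primes; the empty product is 1).
frac : ℕ → ℕ → ℚ
frac n zero = 0ℚ
frac n (suc d) = + n / suc d

ratio : Config → ℚ
ratio c = frac (product (highs c)) (product (lows c))

IsMaximizer : (p P m : ℕ) → Config → Set
IsMaximizer p P m c = Admissible p P m c × (∀ c′ → Admissible p P m c′ → ratio c′ ℚ.≤ ratio c)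

ℕtoℚ : ℕ → ℚ
ℕtoℚ n = + n / 1

F-1>0 : ∀ {F} → 1ℚ ℚ.< F → (F - 1ℚ) ℚ.> 0ℚ
F-1>0 {F} 1<F = subst (ℚ._< F - 1ℚ) (ℚP.+-inverseʳ 1ℚ) (ℚP.+-monoˡ-< (ℚ.- 1ℚ) 1<F)

bound : (m : ℕ) (F : ℚ) → 1ℚ ℚ.< F → ℚ
bound m F 1<F = ((ℕtoℚ m) ℚ.* F) ÷ (F - 1ℚ)
  where instance _ = ℚ.>-nonZero (F-1>0 1<F)

{-# OPTIONS --safe #-}
-- Put t = Q_s ∸ m; if t > 0
-- then t + ∑ (Q_i − q_i) ≤ Q_s.  Since the q_i decrease, each q_i is at least t plus the gaps
-- Q_j − q_j of the earlier pairs, and Q_i / q_i ≤ (T + (Q_i − q_i)) / T whenever T ≤ q_i; these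
-- factors telescope to ratio c ≤ Q_s / t.  Hence F t ≤ Q_s ≤ t + m, i.e. Q_s (F − 1) ≤ m F.
-- The bound Q_s ≤ p_k + m is just Q_s − q_s ≤ m with q_s ≤ p_k.
module Submission where

open import Defs
open import Data.Nat using (ℕ; zero; suc; z≤n; _≤_; _+_; _*_; _∸_)
import Data.Nat.Properties as ℕP
import Data.Nat.Solver as ℕSolver
open import Data.Nat.ListAction using (product)
open import Data.Integer as ℤ using (+_)
import Data.Integer.Properties as ℤP
open import Data.Integer.Tactic.RingSolver using (solve-∀)
open import Data.Rational as Q using (ℚ; 0ℚ; 1ℚ; _⊓_; fromℚᵘ)
import Data.Rational.Properties as ℚP
import Data.Rational.Solver as ℚSolver
open import Data.Rational.Unnormalised as ℚᵘ using (ℚᵘ; mkℚᵘ; *≡*; *≤*)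
import Data.Rational.Unnormalised.Properties as ℚᵘP
open import Data.List using ([]; _∷_; last)
open import Data.Maybe using (just)
open import Data.Product using (Σ; _×_; _,_; proj₁; proj₂)
open import Data.Unit using (⊤; tt)
open import Data.Empty using (⊥-elim)
open import Relation.Nullary using (yes; no)
open import Relation.Binary.PropositionalEquality using (_≡_; refl; sym; trans; cong)

fromℚᵘ-homo-+ : ∀ p q → fromℚᵘ (p ℚᵘ.+ q) ≡ fromℚᵘ p Q.+ fromℚᵘ q
fromℚᵘ-homo-+ p q = ℚP.toℚᵘ-injective (ℚᵘP.≃-trans (ℚP.toℚᵘ-fromℚᵘ (p ℚᵘ.+ q)) (ℚᵘP.≃-sym
  (ℚᵘP.≃-trans (ℚP.toℚᵘ-homo-+ (fromℚᵘ p) (fromℚᵘ q))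
               (ℚᵘP.+-cong (ℚP.toℚᵘ-fromℚᵘ p) (ℚP.toℚᵘ-fromℚᵘ q)))))

fromℚᵘ-homo-* : ∀ p q → fromℚᵘ (p ℚᵘ.* q) ≡ fromℚᵘ p Q.* fromℚᵘ q
fromℚᵘ-homo-* p q = ℚP.toℚᵘ-injective (ℚᵘP.≃-trans (ℚP.toℚᵘ-fromℚᵘ (p ℚᵘ.* q)) (ℚᵘP.≃-sym
  (ℚᵘP.≃-trans (ℚP.toℚᵘ-homo-* (fromℚᵘ p) (fromℚᵘ q))
               (ℚᵘP.*-cong (ℚP.toℚᵘ-fromℚᵘ p) (ℚP.toℚᵘ-fromℚᵘ q)))))

fromℚᵘ-mono-≤ : ∀ {p q} → p ℚᵘ.≤ q → fromℚᵘ p Q.≤ fromℚᵘ q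
fromℚᵘ-mono-≤ {p} {q} p≤q = ℚP.toℚᵘ-cancel-≤
  (ℚᵘP.≤-respˡ-≃ (ℚᵘP.≃-sym (ℚP.toℚᵘ-fromℚᵘ p)) (ℚᵘP.≤-respʳ-≃ (ℚᵘP.≃-sym (ℚP.toℚᵘ-fromℚᵘ q)) p≤q))

-- ℕtoℚ n and frac a (suc b) are definitionally fromℚᵘ (ι n) and fromℚᵘ (mkℚᵘ (+ a) b).
ι : ℕ → ℚᵘ
ι n = mkℚᵘ (+ n) 0

ι-+ : ∀ m n → ι (m + n) ℚᵘ.≃ ι m ℚᵘ.+ ι n
ι-+ m n rewrite ℤP.pos-+ m n = *≡* (normalise (+ m) (+ n))
  where
  normalise : ∀ a b → (a ℤ.+ b) ℤ.* + 1 ≡ (a ℤ.* + 1 ℤ.+ b ℤ.* + 1) ℤ.* + 1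
  normalise = solve-∀

ι-* : ∀ m n → ι (m * n) ℚᵘ.≃ ι m ℚᵘ.* ι n
ι-* m n rewrite ℤP.pos-* m n = *≡* refl

ι-mono-≤ : ∀ {m n} → m ≤ n → ι m ℚᵘ.≤ ι n
ι-mono-≤ m≤n = *≤* (ℤP.*-monoʳ-≤-nonNeg (+ 1) (ℤ.+≤+ m≤n))

ι-*-cancel : ∀ a b → ι (suc b) ℚᵘ.* mkℚᵘ (+ a) b ℚᵘ.≃ ι a
ι-*-cancel a b = *≡* (trans (ℤP.*-identityʳ _) (trans (ℤP.*-comm (+ suc b) (+ a))
  (cong (λ d → + a ℤ.* + d) (sym (ℕP.*-identityˡ (suc b))))))

ℕtoℚ-+ : ∀ m n → ℕtoℚ (m + n) ≡ ℕtoℚ m Q.+ ℕtoℚ n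
ℕtoℚ-+ m n = trans (ℚP.fromℚᵘ-cong (ι-+ m n)) (fromℚᵘ-homo-+ (ι m) (ι n))

ℕtoℚ-* : ∀ m n → ℕtoℚ (m * n) ≡ ℕtoℚ m Q.* ℕtoℚ n
ℕtoℚ-* m n = trans (ℚP.fromℚᵘ-cong (ι-* m n)) (fromℚᵘ-homo-* (ι m) (ι n))

ℕtoℚ-mono-≤ : ∀ {m n} → m ≤ n → ℕtoℚ m Q.≤ ℕtoℚ n
ℕtoℚ-mono-≤ m≤n = fromℚᵘ-mono-≤ (ι-mono-≤ m≤n)

ℕtoℚ-*-frac : ∀ a b → ℕtoℚ (suc b) Q.* frac a (suc b) ≡ ℕtoℚ a
ℕtoℚ-*-frac a b = trans (sym (fromℚᵘ-homo-* (ι (suc b)) (mkℚᵘ (+ a) b))) (ℚP.fromℚᵘ-cong (ι-*-cancel a b))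

ℕtoℚ-nonNeg : ∀ n → Q.NonNegative (ℕtoℚ n)
ℕtoℚ-nonNeg n = Q.nonNegative (ℕtoℚ-mono-≤ {0} {n} z≤n)

ℕtoℚ-pos : ∀ n → Q.Positive (ℕtoℚ (suc n))
ℕtoℚ-pos n = ℚP.normalize-pos (suc n) 1

*≤⇒≤÷ : ∀ {p q} z .{{_ : Q.Positive z}} → p Q.* z Q.≤ q → p Q.≤ (q Q.÷ z) {{ℚP.pos⇒nonZero z}}
*≤⇒≤÷ {p} {q} z pz≤q = ℚP.*-cancelʳ-≤-pos z (begin
  p Q.* z                  ≤⟨ pz≤q ⟩
  q                        ≡⟨ ℚP.*-identityʳ q ⟨
  q Q.* 1ℚ                 ≡⟨ cong (q Q.*_) (ℚP.*-inverseˡ z) ⟨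
  q Q.* (Q.1/ z Q.* z)     ≡⟨ ℚP.*-assoc q (Q.1/ z) z ⟨
  q Q.* Q.1/ z Q.* z       ∎)
  where
  open ℚP.≤-Reasoning
  instance
    z≢0 : Q.NonZero z
    z≢0 = ℚP.pos⇒nonZero z

-- For b = 0 the junk value frac a 0 = 0 still gives the conclusion, as then F ≤ 0.
frac-cross-≤ : ∀ {F} a b t q → F Q.≤ frac a b → a * t ≤ b * q → F Q.* ℕtoℚ t Q.≤ ℕtoℚ q
frac-cross-≤ {F} a zero t q F≤0 _ = begin
  F Q.* ℕtoℚ t    ≤⟨ ℚP.*-monoʳ-≤-nonNeg (ℕtoℚ t) {{ℕtoℚ-nonNeg t}} F≤0 ⟩
  0ℚ Q.* ℕtoℚ t   ≡⟨ ℚP.*-zeroˡ (ℕtoℚ t) ⟩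
  0ℚ              ≤⟨ ℕtoℚ-mono-≤ {0} {q} z≤n ⟩
  ℕtoℚ q          ∎
  where open ℚP.≤-Reasoning
frac-cross-≤ {F} a (suc b) t q F≤a/b at≤bq = ℚP.*-cancelˡ-≤-pos B {{ℕtoℚ-pos b}} (begin
  B Q.* (F Q.* ℕtoℚ t)                   ≤⟨ ℚP.*-monoˡ-≤-nonNeg B {{ℚP.pos⇒nonNeg B {{ℕtoℚ-pos b}}}}
                                              (ℚP.*-monoʳ-≤-nonNeg (ℕtoℚ t) {{ℕtoℚ-nonNeg t}} F≤a/b) ⟩
  B Q.* (frac a (suc b) Q.* ℕtoℚ t)      ≡⟨ ℚP.*-assoc B (frac a (suc b)) (ℕtoℚ t) ⟨
  B Q.* frac a (suc b) Q.* ℕtoℚ t        ≡⟨ cong (Q._* ℕtoℚ t) (ℕtoℚ-*-frac a b) ⟩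
  ℕtoℚ a Q.* ℕtoℚ t                      ≡⟨ ℕtoℚ-* a t ⟨
  ℕtoℚ (a * t)                         ≤⟨ ℕtoℚ-mono-≤ at≤bq ⟩
  ℕtoℚ (suc b * q)                     ≡⟨ ℕtoℚ-* (suc b) q ⟩
  B Q.* ℕtoℚ q                           ∎)
  where
  B = ℕtoℚ (suc b)
  open ℚP.≤-Reasoning

≤-bound : ∀ m F (1<F : 1ℚ Q.< F) {t q} → F Q.* ℕtoℚ t Q.≤ ℕtoℚ q → q ≤ m + t → ℕtoℚ q Q.≤ bound m F 1<F
≤-bound m F 1<F {t} {q} Ft≤q q≤m+t = *≤⇒≤÷ (F Q.- 1ℚ) {{Q.positive (F-1>0 1<F)}} (begin
  q′ Q.* (F Q.- 1ℚ)                  ≡⟨ solve 2 (λ q F → q :* (F :- con 1ℚ) := q :* F :- q) refl q′ F ⟩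
  q′ Q.* F Q.- q′                    ≤⟨ ℚP.+-monoˡ-≤ (Q.- q′) (ℚP.*-monoʳ-≤-nonNeg F {{F≥0}} q′≤m′+t′) ⟩
  (m′ Q.+ t′) Q.* F Q.- q′           ≡⟨ solve 4 (λ m t F q → (m :+ t) :* F :- q := m :* F :+ (F :* t :- q))
                                              refl m′ t′ F q′ ⟩
  m′ Q.* F Q.+ (F Q.* t′ Q.- q′)     ≤⟨ ℚP.+-monoʳ-≤ (m′ Q.* F) (ℚP.+-monoˡ-≤ (Q.- q′) Ft≤q) ⟩
  m′ Q.* F Q.+ (q′ Q.- q′)           ≡⟨ solve 2 (λ a q → a :+ (q :- q) := a) refl (m′ Q.* F) q′ ⟩
  m′ Q.* F                           ∎)
  where
  open ℚSolver.+-*-Solver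
  open ℚP.≤-Reasoning
  q′ = ℕtoℚ q
  t′ = ℕtoℚ t
  m′ = ℕtoℚ m
  F≥0 : Q.NonNegative F
  F≥0 = Q.nonNegative (ℚP.<⇒≤ (ℚP.<-trans (ℚP.positive⁻¹ 1ℚ) 1<F))
  q′≤m′+t′ : q′ Q.≤ m′ Q.+ t′
  q′≤m′+t′ = ℚP.≤-trans (ℕtoℚ-mono-≤ q≤m+t) (ℚP.≤-reflexive (ℕtoℚ-+ m t))

n*o≤m*[o+[n∸m]] : ∀ {m n o} → o ≤ m → n * o ≤ m * (o + (n ∸ m))
n*o≤m*[o+[n∸m]] {m} {n} {o} o≤m = begin
  n * o                    ≤⟨ ℕP.*-monoˡ-≤ o (ℕP.m≤n+m∸n n m) ⟩
  (m + (n ∸ m)) * o        ≡⟨ ℕP.*-distribʳ-+ o m (n ∸ m) ⟩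
  m * o + (n ∸ m) * o    ≤⟨ ℕP.+-monoʳ-≤ (m * o) (ℕP.*-monoʳ-≤ (n ∸ m) o≤m) ⟩
  m * o + (n ∸ m) * m    ≡⟨ cong (λ x → m * o + x) (ℕP.*-comm (n ∸ m) m) ⟩
  m * o + m * (n ∸ m)    ≡⟨ ℕP.*-distribˡ-+ m o (n ∸ m) ⟨
  m * (o + (n ∸ m))      ∎
  where open ℕP.≤-Reasoning

m+[n∸o]≤n⇒m≤o : ∀ {m n o} → m + (n ∸ o) ≤ n → m ≤ o
m+[n∸o]≤n⇒m≤o {m} {n} {o} le with o ℕP.≤? n
... | yes o≤n = ℕP.+-cancelʳ-≤ (n ∸ o) m o (ℕP.≤-trans le (ℕP.≤-reflexive (sym (ℕP.m+[n∸m]≡n o≤n))))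
... | no o≰n  = ℕP.<⇒≤ (ℕP.≤-<-trans (ℕP.≤-trans (ℕP.m≤m+n m (n ∸ o)) le) (ℕP.≰⇒> o≰n))

LowsDominate : ℕ → Config → Set
LowsDominate T []            = ⊤
LowsDominate T ((q , Q) ∷ c) = T ≤ q × LowsDominate (T + (Q ∸ q)) c

product-highs-telescope : ∀ T c → LowsDominate T c →
                          product (highs c) * T ≤ product (lows c) * (T + cost c)
product-highs-telescope T []            _            = ℕP.≤-reflexive (cong (1 *_) (sym (ℕP.+-identityʳ T)))
product-highs-telescope T ((q , Q) ∷ c) (T≤q , dom) = begin
  Q * ΠQ * T                    ≡⟨ solve 3 (λ Q ΠQ T → Q :* ΠQ :* T := ΠQ :* (Q :* T)) refl Q ΠQ T ⟩
  ΠQ * (Q * T)                  ≤⟨ ℕP.*-monoʳ-≤ ΠQ (n*o≤m*[o+[n∸m]] T≤q) ⟩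
  ΠQ * (q * T′)                 ≡⟨ solve 3 (λ ΠQ q T′ → ΠQ :* (q :* T′) := q :* (ΠQ :* T′)) refl ΠQ q T′ ⟩
  q * (ΠQ * T′)                 ≤⟨ ℕP.*-monoʳ-≤ q (product-highs-telescope T′ c dom) ⟩
  q * (Πq * (T′ + cost c))      ≡⟨ solve 5 (λ q Πq T d C → q :* (Πq :* ((T :+ d) :+ C)) := q :* Πq :* (T :+ (d :+ C)))
                                         refl q Πq T (Q ∸ q) (cost c) ⟩
  q * Πq * (T + (Q ∸ q + cost c)) ∎
  where
  open ℕSolver.+-*-Solver
  open ℕP.≤-Reasoning
  ΠQ = product (highs c)
  Πq = product (lows c)
  T′ = T + (Q ∸ q)

last⁺ : ℕ × ℕ → Config → ℕ × ℕ
last⁺ x []       = x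
last⁺ _ (y ∷ ys) = last⁺ y ys

last-highs : ∀ x xs → last (highs (x ∷ xs)) ≡ just (proj₂ (last⁺ x xs))
last-highs x []       = refl
last-highs x (y ∷ ys) = last-highs y ys

AllL-last⁺ : ∀ {P x xs} → AllL P (x ∷ xs) → P (last⁺ x xs)
AllL-last⁺ {xs = []}     (px ∷ _)   = px
AllL-last⁺ {xs = _ ∷ _}  (_ ∷ pxs)  = AllL-last⁺ pxs

gap-last⁺≤cost : ∀ x xs → proj₂ (last⁺ x xs) ∸ proj₁ (last⁺ x xs) ≤ cost (x ∷ xs)
gap-last⁺≤cost x []       = ℕP.m≤m+n _ 0
gap-last⁺≤cost x (y ∷ ys) = ℕP.≤-trans (gap-last⁺≤cost y ys) (ℕP.m≤n+m _ (proj₂ x ∸ proj₁ x))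

low-last⁺≤low : ∀ x xs → QsDecr (lows (x ∷ xs)) → proj₁ (last⁺ x xs) ≤ proj₁ x
low-last⁺≤low x []       _            = ℕP.≤-refl
low-last⁺≤low x (y ∷ ys) (y<x ∷ decr) = ℕP.≤-trans (low-last⁺≤low y ys decr) (ℕP.<⇒≤ y<x)

≤-head-low : ∀ T x xs → QsDecr (lows (x ∷ xs)) → T + cost (x ∷ xs) ≤ proj₂ (last⁺ x xs) → T ≤ proj₁ x
≤-head-low T x xs decr le = ℕP.≤-trans
  (m+[n∸o]≤n⇒m≤o (ℕP.≤-trans (ℕP.+-monoʳ-≤ T (gap-last⁺≤cost x xs)) le))
  (low-last⁺≤low x xs decr)

lowsDominate : ∀ T x xs → QsDecr (lows (x ∷ xs)) → T + cost (x ∷ xs) ≤ proj₂ (last⁺ x xs) →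
               LowsDominate T (x ∷ xs)
lowsDominate T x []       decr            le = ≤-head-low T x [] decr le , tt
lowsDominate T x (y ∷ ys) decr@(_ ∷ decr′) le =
  ≤-head-low T x (y ∷ ys) decr le ,
  lowsDominate (T + (proj₂ x ∸ proj₁ x)) y ys decr′
    (ℕP.≤-trans (ℕP.≤-reflexive (ℕP.+-assoc T (proj₂ x ∸ proj₁ x) (cost (y ∷ ys)))) le)

product-highs-≤ : ∀ {m} x xs → QsDecr (lows (x ∷ xs)) → cost (x ∷ xs) ≤ m →
                  product (highs (x ∷ xs)) * (proj₂ (last⁺ x xs) ∸ m)
                    ≤ product (lows (x ∷ xs)) * proj₂ (last⁺ x xs)
product-highs-≤ {m} x xs decr cost≤m with proj₂ (last⁺ x xs) ℕP.≤? m
... | yes Qs≤m rewrite ℕP.m≤n⇒m∸n≡0 Qs≤m | ℕP.*-zeroʳ (product (highs (x ∷ xs))) = z≤n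
... | no Qs≰m = ℕP.≤-trans (product-highs-telescope t (x ∷ xs) (lowsDominate t x xs decr t+cost≤Qs))
                           (ℕP.*-monoʳ-≤ (product (lows (x ∷ xs))) t+cost≤Qs)
  where
  Qs = proj₂ (last⁺ x xs)
  t = Qs ∸ m
  t+cost≤Qs : t + cost (x ∷ xs) ≤ Qs
  t+cost≤Qs = ℕP.≤-trans (ℕP.+-monoʳ-≤ t cost≤m) (ℕP.≤-reflexive (ℕP.m∸n+n≡m (ℕP.<⇒≤ (ℕP.≰⇒> Qs≰m))))

lemma9 : (k m p P : ℕ) → 3 ≤ k → IsKthPrime k p → IsKthPrime (suc k) P → m ≤ P ∸ 3 →
    (c : Config) → IsMaximizer p P m c →
    (F : ℚ) → (1<F : 1ℚ Q.< F) → F Q.≤ ratio c →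
    Σ ℕ (λ Qs → last (highs c) ≡ just Qs ×
    ℕtoℚ Qs Q.≤ (ℕtoℚ (p + m) ⊓ bound m F 1<F))
lemma9 _ _ _ _ _ _ _ _ [] _ F 1<F F≤1 = ⊥-elim (ℚP.<-irrefl refl (ℚP.<-≤-trans 1<F F≤1))
lemma9 _ m p _ _ _ _ _ (x ∷ xs) ((bounds , decr , _ , cost≤m) , _) F 1<F F≤ratio =
  Qs , last-highs x xs , ℚP.⊓-glb (ℕtoℚ-mono-≤ Qs≤p+m) (≤-bound m F 1<F F[Qs∸m]≤Qs (ℕP.m≤n+m∸n Qs m))
  where
  Qs = proj₂ (last⁺ x xs)
  qs = proj₁ (last⁺ x xs)
  qs≤p : qs ≤ p
  qs≤p = proj₁ (proj₂ (proj₂ (AllL-last⁺ bounds)))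
  Qs≤p+m : Qs ≤ p + m
  Qs≤p+m = ℕP.≤-trans (ℕP.m≤n+m∸n Qs qs) (ℕP.+-mono-≤ qs≤p (ℕP.≤-trans (gap-last⁺≤cost x xs) cost≤m))
  F[Qs∸m]≤Qs : F Q.* ℕtoℚ (Qs ∸ m) Q.≤ ℕtoℚ Qs
  F[Qs∸m]≤Qs = frac-cross-≤ (product (highs (x ∷ xs))) (product (lows (x ∷ xs))) (Qs ∸ m) Qs F≤ratio
     (product-highs-≤ x xs decr cost≤m)
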